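{- Let $G=(A,B,E)$ and $H=(B,C,F)$ be balanced bipartite graphs with $|A|=|B|=|C|=n$, sharing the vertex class $B$, and let $G*H=(A,C,W)$ be their join. Then: (i) if $G$ and $H$ are both $\alpha^+$-stable, then $G*H$ is $\alpha^+$-stable; (ii) if one of $G,H$ is $\alpha^+$-stable and the other is bistable, then $G*H$ is bistable; (iii) if $G$ and $H$ are both bistable, then $G*H$ is bistable.
   Context: All graphs are finite and simple. The join $G*H=(A,C,W)$ is the bipartite graph with classes $A$ and $C$ in which $ac\in W$ if and only if there exists $b\in B$ with $ab\in E$ and $bc\in F$. $\alpha(G)$ is the largest size of a stable set; a maximum stable set is a stable set of that size. A graph is $\alpha^+$-stable if $\alpha(G+e)=\alpha(G)$ for every pair $e=xy$ of distinct nonadjacent vertices. A bipartite graph with bipartition $(P,Q)$ is bistable if $P$ and $Q$ are exactly its two maximum stable sets. -}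

module Defs where

open import Data.Nat using (ℕ; _+_; _≤_)
open import Data.Fin using (Fin; splitAt)
open import Data.Fin.Subset using (Subset; _∈_; ∣_∣)
open import Data.Bool using (Bool; true; false)
open import Data.Vec using (tabulate)
open import Data.Sum using (_⊎_; inj₁; inj₂)
open import Data.Product using (Σ; _×_; ∃)
open import Relation.Nullary using (¬_)
open import Relation.Binary.PropositionalEquality using (_≡_; _≢_)
open import Level using (0ℓ)

Graph : ℕ → Set₁
Graph m = Fin m → Fin m → Set

addEdge : ∀ {m} → Graph m → Fin m → Fin m → Graph m
addEdge G u v x y = G x y ⊎ ((x ≡ u × y ≡ v) ⊎ (x ≡ v × y ≡ u))

Stable : ∀ {m} → Graph m → Subset m → Set
Stable G S = ∀ x y → x ∈ S → y ∈ S → ¬ G x y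

MaxStable : ∀ {m} → Graph m → Subset m → Set
MaxStable G S = Stable G S × (∀ T → Stable G T → ∣ T ∣ ≤ ∣ S ∣)

Alpha≡ : ∀ {m} → Graph m → ℕ → Set
Alpha≡ G k = (∃ λ S → MaxStable G S × ∣ S ∣ ≡ k)

AlphaPlusStable : ∀ {m} → Graph m → Set
AlphaPlusStable G = ∀ x y → x ≢ y → ¬ G x y → ∀ k → Alpha≡ G k → Alpha≡ (addEdge G x y) k

-- A balanced bipartite graph (X, Y, E) with |X| = |Y| = n, given by its
-- bipartite adjacency relation E ⊆ X × Y (X, Y are both copies of Fin n).
BiGraph : ℕ → Set₁
BiGraph n = Fin n → Fin n → Set

-- Underlying graph on Fin (n + n): vertices splitting as inj₁ are the first class,
-- inj₂ the second class.
adjUnder : ∀ {n} → BiGraph n → Fin n ⊎ Fin n → Fin n ⊎ Fin n → Set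
adjUnder E (inj₁ a) (inj₂ b) = E a b
adjUnder E (inj₂ b) (inj₁ a) = E a b
adjUnder E _ _ = Data.Empty.⊥
  where import Data.Empty

underlying : ∀ {n} → BiGraph n → Graph (n + n)
underlying {n} E x y = adjUnder E (splitAt n x) (splitAt n y)

isLeft : ∀ {n} → Fin n ⊎ Fin n → Bool
isLeft (inj₁ _) = true
isLeft (inj₂ _) = false

isRight : ∀ {n} → Fin n ⊎ Fin n → Bool
isRight (inj₁ _) = false
isRight (inj₂ _) = true

leftClass : ∀ n → Subset (n + n)
leftClass n = tabulate (λ i → isLeft (splitAt n i))

rightClass : ∀ n → Subset (n + n)
rightClass n = tabulate (λ i → isRight (splitAt n i))

_⋆_ : ∀ {n} → BiGraph n → BiGraph n → BiGraph n
(E ⋆ F) a c = Σ (Fin _) λ b → E a b × F b c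

BiAlphaPlusStable : ∀ {n} → BiGraph n → Set
BiAlphaPlusStable E = AlphaPlusStable (underlying E)

Bistable : ∀ {n} → BiGraph n → Set
Bistable {n} E =
  MaxStable (underlying E) (leftClass n) × MaxStable (underlying E) (rightClass n)
  × (∀ S → MaxStable (underlying E) S → S ≡ leftClass n ⊎ S ≡ rightClass n)

-- Call X ⊆ A, Y ⊆ B with no edge between them a stable pair. Both classes are
-- stable of size n, so α = n iff every stable pair has |X| + |Y| ≤ n, which
-- (taking Y = B ∖ N(X)) is Hall's condition |N(X)| ≥ |X|.
-- Under Hall's condition the graph is α⁺-stable, since for any two vertices
-- one of the classes misses one of them. Conversely, if α > n, maximum stable
-- pairs are closed under (X ∩ P, Y ∪ Q) and (X ∪ P, Y ∩ Q); hence the X of a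
-- maximum pair minimising |X| lies inside every maximum pair, and likewise for
-- the Y minimising |Y|. For a in the former and b in the latter, ab is a
-- non-edge whose addition lowers α.
-- Bistability is Hall's condition plus: the classes are the only stable pairs
-- of size n. Both properties pass to the join through neighbourhoods: if
-- X ∪ Z is stable in G * H, then X ∪ (B ∖ N(X)) is stable in G and N(X) ∪ Z
-- in H, and Hall's condition for G gives |X| ≤ |N(X)|.
-- The edge relations are not decidable, so neighbourhoods and extremal pairs
-- exist only under double negation; every conclusion drawn from them is
-- decidable.
module Submission where

open import Defs
open import Data.Bool using (true; false; not)
import Data.Bool.Properties as Bool
open import Data.Fin using (Fin; zero; suc; splitAt; _↑ˡ_; _↑ʳ_)
open import Data.Fin.Properties using (splitAt-↑ˡ; splitAt-↑ʳ)
open import Data.Fin.Subset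
  using (Subset; _∈_; _⊆_; _⊂_; ∣_∣; ⊤; ⊥; ∁; _∩_; _∪_; Nonempty)
open import Data.Fin.Subset.Properties
  using ( _∈?_; ∣p∣≤n; ∣⊥∣≡0; ∣⊤∣≡n; ∣p∣≡n⇒p≡⊤; ∣∁p∣≡n∸∣p∣; nonempty?; Empty-unique
        ; x∈p⇒∣p-x∣<∣p∣; ∉⊥; x∈p⇒x∉∁p; x∈∁p⇒x∉p; p∩q⊆p; p⊂q⇒∣p∣<∣q∣
        ; x∈p∩q⁻; x∈p∪q⁻ )
open import Data.Nat using (ℕ; zero; suc; _+_; _∸_; _≤_; _<_; _≤?_; z≤n; z<s)
open import Data.Nat.Properties
  using ( ≤-refl; ≤-reflexive; ≤⇒≯; n≮0; ≤-trans; ≤-antisym; ≤-pred; ≮⇒≥; <-≤-trans; ≤-<-trans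
        ; +-identityʳ; +-comm; +-suc; +-cancelˡ-≡; +-cancelʳ-≤; +-monoˡ-≤; +-monoʳ-≤; +-mono-≤; <⇒≢
        ; ∸-cancelʳ-≤; m+[n∸m]≡n; +-commutativeSemigroup )
open import Algebra.Properties.CommutativeSemigroup +-commutativeSemigroup using (interchange)
open import Data.Product using (∃; ∃₂; _×_; _,_; proj₁; proj₂; uncurry)
open import Data.Sum using (_⊎_; inj₁; inj₂; [_,_]′)
import Data.Sum as Sum
open import Data.Vec using ([]; _∷_; here; there; _++_; tabulate; replicate)
import Data.Vec as Vec
open import Data.Vec.Properties
  using ( lookup-splitAt; []=⇒lookup; lookup⇒[]=; ++-injective; tabulate-∘; map-const; map-++
        ; map-replicate; ≡-dec )
open import Effect.Monad using (RawMonad)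
open import Function using (_∘_; id; const; _⇔_; Equivalence; mk⇔)
open import Relation.Binary.PropositionalEquality
open import Relation.Nullary using (¬_; Dec; does; yes; no; contradiction)
open import Relation.Nullary.Decidable using (decidable-stable; ¬¬-excluded-middle; _×-dec_; _⊎-dec_)
open import Relation.Nullary.Negation using (¬¬-Monad)

open import Level using (0ℓ)

open RawMonad (¬¬-Monad {0ℓ}) using (_<$>_; _>>=_; return)

private
  variable
    A : Set
    m n k : ℕ

¬¬-least : (P : A → Set) (f : A → ℕ) {x : A} → P x →
           ¬ ¬ (∃ λ y → P y × ∀ {z} → P z → f y ≤ f z)
¬¬-least P f {x} px = go (f x) px ≤-refl
  where
  go : ∀ bound {x} → P x → f x ≤ bound → ¬ ¬ (∃ λ y → P y × ∀ {z} → P z → f y ≤ f z)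
  go zero {x} px fx≤0 = return (x , px , λ {z} _ → ≤-trans fx≤0 z≤n)
  go (suc bound) {x} px fx≤ = ¬¬-excluded-middle {A = ∃ λ z → P z × f z < f x} >>= λ where
    (yes (z , pz , fz<fx)) → go bound pz (≤-pred (≤-trans fz<fx fx≤))
    (no ∄smaller) → return (x , px , λ {z} pz → ≮⇒≥ (λ fz<fx → ∄smaller (_ , pz , fz<fx)))

¬¬-greatest : (P : A → Set) (f : A → ℕ) {N : ℕ} → (∀ {x} → P x → f x ≤ N) → {x : A} → P x →
              ¬ ¬ (∃ λ y → P y × ∀ {z} → P z → f z ≤ f y)
¬¬-greatest P f {N} bounded px = do
  (y , py , least) ← ¬¬-least P (λ x → N ∸ f x) px
  return (y , py , λ {z} pz → ∸-cancelʳ-≤ (bounded pz) (least pz))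

¬¬-subset : (P : Fin n → Set) → ¬ ¬ (∃ λ (X : Subset n) → ∀ i → i ∈ X ⇔ P i)
¬¬-subset {zero} P = return ([] , λ ())
¬¬-subset {suc n} P = do
  P0? ← ¬¬-excluded-middle
  (X , X⇔P) ← ¬¬-subset (P ∘ suc)
  return (does P0? ∷ X , λ where
    zero → head⇔ P0?
    (suc i) → mk⇔ (λ { (there i∈X) → Equivalence.to (X⇔P i) i∈X }) (there ∘ Equivalence.from (X⇔P i)))
  where
  head⇔ : ∀ {B : Set} {X : Subset n} (B? : Dec B) → zero ∈ does B? ∷ X ⇔ B
  head⇔ (yes b) = mk⇔ (λ _ → b) (λ _ → here)
  head⇔ (no ¬b) = mk⇔ (λ ()) (λ b → contradiction b ¬b)

∣p++q∣≡∣p∣+∣q∣ : (p : Subset m) (q : Subset n) → ∣ p ++ q ∣ ≡ ∣ p ∣ + ∣ q ∣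
∣p++q∣≡∣p∣+∣q∣ [] q = refl
∣p++q∣≡∣p∣+∣q∣ (true ∷ p) q = cong suc (∣p++q∣≡∣p∣+∣q∣ p q)
∣p++q∣≡∣p∣+∣q∣ (false ∷ p) q = ∣p++q∣≡∣p∣+∣q∣ p q

∣p∩q∣+∣p∪q∣≡∣p∣+∣q∣ : (p q : Subset n) → ∣ p ∩ q ∣ + ∣ p ∪ q ∣ ≡ ∣ p ∣ + ∣ q ∣
∣p∩q∣+∣p∪q∣≡∣p∣+∣q∣ [] [] = refl
∣p∩q∣+∣p∪q∣≡∣p∣+∣q∣ (true ∷ p) (true ∷ q) =
  cong suc (trans (+-suc _ _) (trans (cong suc (∣p∩q∣+∣p∪q∣≡∣p∣+∣q∣ p q)) (sym (+-suc _ _))))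
∣p∩q∣+∣p∪q∣≡∣p∣+∣q∣ (true ∷ p) (false ∷ q) = trans (+-suc _ _) (cong suc (∣p∩q∣+∣p∪q∣≡∣p∣+∣q∣ p q))
∣p∩q∣+∣p∪q∣≡∣p∣+∣q∣ (false ∷ p) (true ∷ q) =
  trans (+-suc _ _) (trans (cong suc (∣p∩q∣+∣p∪q∣≡∣p∣+∣q∣ p q)) (sym (+-suc _ _)))
∣p∩q∣+∣p∪q∣≡∣p∣+∣q∣ (false ∷ p) (false ∷ q) = ∣p∩q∣+∣p∪q∣≡∣p∣+∣q∣ p q

∣p∣+∣∁p∣≡n : (p : Subset n) → ∣ p ∣ + ∣ ∁ p ∣ ≡ n
∣p∣+∣∁p∣≡n p = trans (cong (∣ p ∣ +_) (∣∁p∣≡n∸∣p∣ p)) (m+[n∸m]≡n (∣p∣≤n p))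

∣p∣≡0⇒p≡⊥ : {p : Subset n} → ∣ p ∣ ≡ 0 → p ≡ ⊥
∣p∣≡0⇒p≡⊥ ∣p∣≡0 = Empty-unique λ (_ , x∈p) → n≮0 (<-≤-trans (x∈p⇒∣p-x∣<∣p∣ x∈p) (≤-reflexive ∣p∣≡0))

0<∣p∣⇒Nonempty : {p : Subset n} → 0 < ∣ p ∣ → Nonempty p
0<∣p∣⇒Nonempty {n} {p} 0<∣p∣ with nonempty? p
... | yes ∃x∈p = ∃x∈p
... | no ∄x∈p = contradiction (subst (0 <_) (trans (cong ∣_∣ (Empty-unique ∄x∈p)) (∣⊥∣≡0 n)) 0<∣p∣) λ ()

∣p∣≤∣p∩q∣⇒p⊆q : {p q : Subset n} → ∣ p ∣ ≤ ∣ p ∩ q ∣ → p ⊆ q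
∣p∣≤∣p∩q∣⇒p⊆q {p = p} {q} ∣p∣≤∣p∩q∣ {x} x∈p with x ∈? q
... | yes x∈q = x∈q
... | no x∉q = contradiction (p⊂q⇒∣p∣<∣q∣ p∩q⊂p) (≤⇒≯ ∣p∣≤∣p∩q∣)
  where
  p∩q⊂p : p ∩ q ⊂ p
  p∩q⊂p = p∩q⊆p p q , x , x∈p , x∉q ∘ proj₂ ∘ x∈p∩q⁻ p q

module _ {G : Graph m} {x y : Fin m} {T : Subset m} where

  stable-addEdge⁺ : Stable G T → ¬ (x ∈ T × y ∈ T) → Stable (addEdge G x y) T
  stable-addEdge⁺ stable _ u v u∈T v∈T (inj₁ Guv) = stable u v u∈T v∈T Guv
  stable-addEdge⁺ _ ¬both u v u∈T v∈T (inj₂ (inj₁ (refl , refl))) = ¬both (u∈T , v∈T)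
  stable-addEdge⁺ _ ¬both u v u∈T v∈T (inj₂ (inj₂ (refl , refl))) = ¬both (v∈T , u∈T)

  stable-addEdge⁻ : Stable (addEdge G x y) T → Stable G T × ¬ (x ∈ T × y ∈ T)
  stable-addEdge⁻ stable =
    (λ u v u∈T v∈T → stable u v u∈T v∈T ∘ inj₁) ,
    (λ (x∈T , y∈T) → stable x y x∈T y∈T (inj₂ (inj₁ (refl , refl))))

∈-++⁺ˡ : {p : Subset m} {q : Subset n} {i : Fin m} → i ∈ p → i ↑ˡ n ∈ p ++ q
∈-++⁺ˡ here = here
∈-++⁺ˡ (there i∈p) = there (∈-++⁺ˡ i∈p)

∈-++⁺ʳ : (p : Subset m) {q : Subset n} {i : Fin n} → i ∈ q → m ↑ʳ i ∈ p ++ q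
∈-++⁺ʳ [] i∈q = i∈q
∈-++⁺ʳ (_ ∷ p) i∈q = there (∈-++⁺ʳ p i∈q)

∈-++⁻ : (p : Subset m) (q : Subset n) {i : Fin (m + n)} → i ∈ p ++ q → [ _∈ p , _∈ q ]′ (splitAt m i)
∈-++⁻ {m} p q {i} i∈p++q with splitAt m i | lookup-splitAt m p q i
... | inj₁ j | eq = lookup⇒[]= j p (trans (sym eq) ([]=⇒lookup i∈p++q))
... | inj₂ j | eq = lookup⇒[]= j q (trans (sym eq) ([]=⇒lookup i∈p++q))

StablePair : BiGraph n → Subset n → Subset n → Set
StablePair E X Y = ∀ {a b} → a ∈ X → b ∈ Y → ¬ E a b

StablePairOfSize : BiGraph n → ℕ → Subset n → Subset n → Set
StablePairOfSize E k X Y = StablePair E X Y × ∣ X ∣ + ∣ Y ∣ ≡ k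

StablePairsAtMost : BiGraph n → ℕ → Set
StablePairsAtMost E k = ∀ {X Y} → StablePair E X Y → ∣ X ∣ + ∣ Y ∣ ≤ k

Hall : BiGraph n → Set
Hall {n} E = StablePairsAtMost E n

IsClassPair : Subset n → Subset n → Set
IsClassPair X Y = (X ≡ ⊤ × Y ≡ ⊥) ⊎ (X ≡ ⊥ × Y ≡ ⊤)

OnlyClassPairs : BiGraph n → Set
OnlyClassPairs {n} E = ∀ {X Y} → StablePairOfSize E n X Y → IsClassPair X Y

underlying-↑ : (E : BiGraph n) (a b : Fin n) → underlying E (a ↑ˡ n) (n ↑ʳ b) ≡ E a b
underlying-↑ {n} E a b = cong₂ (adjUnder E) (splitAt-↑ˡ n a n) (splitAt-↑ʳ n n b)

↑ˡ≢↑ʳ : (a b : Fin n) → a ↑ˡ n ≢ n ↑ʳ b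
↑ˡ≢↑ʳ {n} a b eq with trans (sym (splitAt-↑ˡ n a n)) (trans (cong (splitAt n) eq) (splitAt-↑ʳ n n b))
... | ()

module _ {n} {E : BiGraph n} {X Y : Subset n} where

  stablePair⇒stable : StablePair E X Y → Stable (underlying E) (X ++ Y)
  stablePair⇒stable stable x y x∈ y∈ =
    across (splitAt n x) (splitAt n y) (∈-++⁻ X Y x∈) (∈-++⁻ X Y y∈)
    where
    across : ∀ u v → [ _∈ X , _∈ Y ]′ u → [ _∈ X , _∈ Y ]′ v → ¬ adjUnder E u v
    across (inj₁ a) (inj₂ b) a∈X b∈Y = stable a∈X b∈Y
    across (inj₂ b) (inj₁ a) b∈Y a∈X = stable a∈X b∈Y

  stable⇒stablePair : Stable (underlying E) (X ++ Y) → StablePair E X Y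
  stable⇒stablePair stable {a} {b} a∈X b∈Y =
    stable _ _ (∈-++⁺ˡ a∈X) (∈-++⁺ʳ X b∈Y) ∘ subst id (sym (underlying-↑ E a b))

stable-size : {E : BiGraph n} → StablePairsAtMost E k →
              ∀ {T} → Stable (underlying E) T → ∣ T ∣ ≤ k
stable-size {n} {k} bounded {T} stable with Vec.splitAt n T
... | X , Y , refl =
  subst (_≤ k) (sym (∣p++q∣≡∣p∣+∣q∣ X Y)) (bounded (stable⇒stablePair {X = X} {Y} stable))

maximumPair⇒maxStable : {E : BiGraph n} {X Y : Subset n} → StablePairsAtMost E k →
                        StablePairOfSize E k X Y → MaxStable (underlying E) (X ++ Y)
maximumPair⇒maxStable {X = X} {Y} bounded (stable , size) =
  stablePair⇒stable stable ,
  λ T stableT → subst (∣ T ∣ ≤_) (sym (trans (∣p++q∣≡∣p∣+∣q∣ X Y) size)) (stable-size bounded stableT)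

tabulate-splitAt : ∀ m (h : Fin m ⊎ Fin n → A) →
                   tabulate (h ∘ splitAt m) ≡ tabulate (h ∘ inj₁) ++ tabulate (h ∘ inj₂)
tabulate-splitAt zero h = refl
tabulate-splitAt (suc m) h = cong (h (inj₁ zero) ∷_) (tabulate-splitAt m (h ∘ Sum.map₁ suc))

tabulate-const : (x : A) → tabulate {n = n} (const x) ≡ replicate n x
tabulate-const x = trans (tabulate-∘ (const x) id) (map-const _ x)

leftClass≡⊤++⊥ : leftClass n ≡ ⊤ {n} ++ ⊥ {n}
leftClass≡⊤++⊥ {n} =
  trans (tabulate-splitAt n (isLeft {n}))
        (cong₂ (λ (p q : Subset n) → p ++ q) (tabulate-const true) (tabulate-const false))

rightClass≡⊥++⊤ : rightClass n ≡ ⊥ {n} ++ ⊤ {n}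
rightClass≡⊥++⊤ {n} =
  trans (tabulate-splitAt n (isRight {n}))
        (cong₂ (λ (p q : Subset n) → p ++ q) (tabulate-const false) (tabulate-const true))

⊥++⊤≡∁[⊤++⊥] : ⊥ {n} ++ ⊤ {n} ≡ ∁ (⊤ {n} ++ ⊥ {n})
⊥++⊤≡∁[⊤++⊥] {n} =
  sym (trans (map-++ not (⊤ {n}) (⊥ {n}))
             (cong₂ (λ (p q : Subset n) → p ++ q) (map-replicate not true n) (map-replicate not false n)))

classPair-stable : {E : BiGraph n} {X Y : Subset n} → IsClassPair X Y → StablePair E X Y
classPair-stable (inj₁ (_ , refl)) _ b∈⊥ = contradiction b∈⊥ ∉⊥
classPair-stable (inj₂ (refl , _)) a∈⊥ _ = contradiction a∈⊥ ∉⊥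

classPair-size : {X Y : Subset n} → IsClassPair X Y → ∣ X ∣ + ∣ Y ∣ ≡ n
classPair-size {n} (inj₁ (refl , refl)) = trans (cong₂ _+_ (∣⊤∣≡n n) (∣⊥∣≡0 n)) (+-identityʳ n)
classPair-size {n} (inj₂ (refl , refl)) = cong₂ _+_ (∣⊥∣≡0 n) (∣⊤∣≡n n)

classPair-∣++∣ : {X Y : Subset n} → IsClassPair X Y → ∣ X ++ Y ∣ ≡ n
classPair-∣++∣ {X = X} {Y} class = trans (∣p++q∣≡∣p∣+∣q∣ X Y) (classPair-size class)

classPair-avoiding : (x y : Fin (n + n)) → ∃₂ λ X Y → IsClassPair X Y × ¬ (x ∈ X ++ Y × y ∈ X ++ Y)
classPair-avoiding {n} x y with x ∈? (⊤ {n} ++ ⊥ {n})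
... | yes x∈⊤++⊥ = ⊥ {n} , ⊤ {n} , inj₂ (refl , refl) , λ (x∈⊥++⊤ , _) →
  x∈p⇒x∉∁p x∈⊤++⊥ (subst (x ∈_) (⊥++⊤≡∁[⊤++⊥] {n}) x∈⊥++⊤)
... | no x∉⊤++⊥ = ⊤ {n} , ⊥ {n} , inj₁ (refl , refl) , λ (x∈⊤++⊥ , _) → x∉⊤++⊥ x∈⊤++⊥

module _ {n} {E : BiGraph n} (hall : Hall E) where

  classPair-maxStable : {X Y : Subset n} → IsClassPair X Y → MaxStable (underlying E) (X ++ Y)
  classPair-maxStable class =
    maximumPair⇒maxStable hall (classPair-stable {E = E} class , classPair-size class)

  maxStable-size≡n : ∀ {S} → MaxStable (underlying E) S → ∣ S ∣ ≡ n
  maxStable-size≡n {S} (stableS , maximal) = ≤-antisym (stable-size hall stableS) n≤∣S∣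
    where
    ⊤∪⊥ : IsClassPair (⊤ {n}) ⊥
    ⊤∪⊥ = inj₁ (refl , refl)
    n≤∣S∣ : n ≤ ∣ S ∣
    n≤∣S∣ = subst (_≤ ∣ S ∣) (classPair-∣++∣ ⊤∪⊥) (maximal _ (proj₁ (classPair-maxStable ⊤∪⊥)))

  hall⇒αPlusStable : BiAlphaPlusStable E
  hall⇒αPlusStable x y _ _ k (S , maxS , ∣S∣≡k) with classPair-avoiding x y
  ... | X , Y , class , avoiding =
    X ++ Y ,
    (stable-addEdge⁺ (stablePair⇒stable (classPair-stable {E = E} class)) avoiding ,
     λ T stableT → subst (∣ T ∣ ≤_) (sym (classPair-∣++∣ class))
                         (stable-size hall (proj₁ (stable-addEdge⁻ stableT)))) ,
    trans (classPair-∣++∣ class) (trans (sym (maxStable-size≡n maxS)) ∣S∣≡k)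

  hall×onlyClassPairs⇒bistable : OnlyClassPairs E → Bistable E
  hall×onlyClassPairs⇒bistable only =
    subst (MaxStable _) (sym leftClass≡⊤++⊥) (classPair-maxStable (inj₁ (refl , refl))) ,
    subst (MaxStable _) (sym rightClass≡⊥++⊤) (classPair-maxStable (inj₂ (refl , refl))) ,
    classes-only
    where
    classes-only : ∀ S → MaxStable (underlying E) S → S ≡ leftClass n ⊎ S ≡ rightClass n
    classes-only S maxS with Vec.splitAt n S
    ... | X , Y , refl
      with only {X} {Y} (stable⇒stablePair (proj₁ maxS) ,
                         trans (sym (∣p++q∣≡∣p∣+∣q∣ X Y)) (maxStable-size≡n maxS))
    ... | inj₁ (refl , refl) = inj₁ (sym leftClass≡⊤++⊥)
    ... | inj₂ (refl , refl) = inj₂ (sym rightClass≡⊥++⊤)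

module _ {n} {E : BiGraph n} where

  bistable⇒hall : Bistable E → Hall E
  bistable⇒hall ((_ , maximal) , _) {X} {Y} stable =
    subst₂ _≤_ (∣p++q∣≡∣p∣+∣q∣ X Y) ∣leftClass∣≡n (maximal _ (stablePair⇒stable stable))
    where
    ∣leftClass∣≡n =
      trans (cong ∣_∣ (leftClass≡⊤++⊥ {n})) (classPair-∣++∣ {X = ⊤} {⊥} (inj₁ (refl , refl)))

  bistable⇒onlyClassPairs : Bistable E → OnlyClassPairs E
  bistable⇒onlyClassPairs bistable@(_ , _ , classes-only) {X} {Y} tight
    with classes-only (X ++ Y) (maximumPair⇒maxStable (bistable⇒hall bistable) tight)
  ... | inj₁ eq = inj₁ (++-injective X ⊤ (trans eq leftClass≡⊤++⊥))
  ... | inj₂ eq = inj₂ (++-injective X ⊥ (trans eq rightClass≡⊥++⊤))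

hall-∁ : {E : BiGraph n} {X Y : Subset n} → Hall E → StablePair E X (∁ Y) → ∣ X ∣ ≤ ∣ Y ∣
hall-∁ {X = X} {Y} hall stable =
  +-cancelʳ-≤ (∣ ∁ Y ∣) (∣ X ∣) (∣ Y ∣) (subst (∣ X ∣ + ∣ ∁ Y ∣ ≤_) (sym (∣p∣+∣∁p∣≡n Y)) (hall stable))

m+n≡m⇒n≡0 : ∀ m {n} → m + n ≡ m → n ≡ 0
m+n≡m⇒n≡0 m m+n≡m = +-cancelˡ-≡ m _ 0 (trans m+n≡m (sym (+-identityʳ m)))

classPair⁺ˡ : {X Y : Subset n} → ∣ X ∣ + ∣ Y ∣ ≡ n → X ≡ ⊤ ⊎ X ≡ ⊥ → IsClassPair X Y
classPair⁺ˡ {n} size (inj₁ refl) rewrite ∣⊤∣≡n n = inj₁ (refl , ∣p∣≡0⇒p≡⊥ (m+n≡m⇒n≡0 n size))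
classPair⁺ˡ {n} size (inj₂ refl) rewrite ∣⊥∣≡0 n = inj₂ (refl , ∣p∣≡n⇒p≡⊤ size)

classPair⁺ʳ : {X Y : Subset n} → ∣ X ∣ + ∣ Y ∣ ≡ n → Y ≡ ⊥ ⊎ Y ≡ ⊤ → IsClassPair X Y
classPair⁺ʳ {n} {X} size (inj₁ refl) rewrite ∣⊥∣≡0 n | +-identityʳ ∣ X ∣ = inj₁ (∣p∣≡n⇒p≡⊤ size , refl)
classPair⁺ʳ {n} {X} size (inj₂ refl) rewrite ∣⊤∣≡n n =
  inj₂ (∣p∣≡0⇒p≡⊥ (m+n≡m⇒n≡0 n (trans (+-comm n ∣ X ∣) size)) , refl)

isClassPair? : (X Y : Subset n) → Dec (IsClassPair X Y)
isClassPair? X Y = (X ≟ ⊤ ×-dec Y ≟ ⊥) ⊎-dec (X ≟ ⊥ ×-dec Y ≟ ⊤)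
  where _≟_ = ≡-dec Bool._≟_

module _ {n} {E F : BiGraph n} where

  ⋆-stablePair⁻ : {X Z : Subset n} → StablePair (E ⋆ F) X Z →
                  ¬ ¬ (∃ λ Y → StablePair E X (∁ Y) × StablePair F Y Z)
  ⋆-stablePair⁻ {X} {Z} stable = split <$> ¬¬-subset N[X]
    where
    N[X] : Fin n → Set
    N[X] b = ∃ λ a → a ∈ X × E a b

    X∪∁Y-stable : ∀ {Y} → (∀ b → b ∈ Y ⇔ N[X] b) → StablePair E X (∁ Y)
    X∪∁Y-stable Y⇔N[X] a∈X b∈∁Y Eab = x∈∁p⇒x∉p b∈∁Y (Equivalence.from (Y⇔N[X] _) (_ , a∈X , Eab))

    Y∪Z-stable : ∀ {Y} → (∀ b → b ∈ Y ⇔ N[X] b) → StablePair F Y Z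
    Y∪Z-stable Y⇔N[X] b∈Y c∈Z Fbc with Equivalence.to (Y⇔N[X] _) b∈Y
    ... | _ , a∈X , Eab = stable a∈X c∈Z (_ , Eab , Fbc)

    split : (∃ λ Y → ∀ b → b ∈ Y ⇔ N[X] b) → ∃ λ Y → StablePair E X (∁ Y) × StablePair F Y Z
    split (Y , Y⇔N[X]) = Y , X∪∁Y-stable Y⇔N[X] , Y∪Z-stable Y⇔N[X]

  module _ (hallE : Hall E) (hallF : Hall F) where

    ⋆-hall : Hall (E ⋆ F)
    ⋆-hall {X} {Z} stable = decidable-stable (_ ≤? n) do
      (Y , stableE , stableF) ← ⋆-stablePair⁻ stable
      return (≤-trans (+-monoˡ-≤ (∣ Z ∣) (hall-∁ hallE stableE)) (hallF stableF))

    ⋆-tightPair⁻ : {X Z : Subset n} → StablePairOfSize (E ⋆ F) n X Z →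
                   ¬ ¬ (∃ λ Y → StablePairOfSize E n X (∁ Y) × StablePairOfSize F n Y Z)
    ⋆-tightPair⁻ {X} {Z} (stable , size) = tighten <$> ⋆-stablePair⁻ stable
      where
      tighten : (∃ λ Y → StablePair E X (∁ Y) × StablePair F Y Z) →
                ∃ λ Y → StablePairOfSize E n X (∁ Y) × StablePairOfSize F n Y Z
      tighten (Y , stableE , stableF) =
        Y , (stableE , trans (cong (_+ ∣ ∁ Y ∣) ∣X∣≡∣Y∣) (∣p∣+∣∁p∣≡n Y)) ,
            (stableF , trans (cong (_+ ∣ Z ∣) (sym ∣X∣≡∣Y∣)) size)
        where
        ∣X∣≡∣Y∣ : ∣ X ∣ ≡ ∣ Y ∣
        ∣X∣≡∣Y∣ = ≤-antisym (hall-∁ hallE stableE)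
                   (+-cancelʳ-≤ (∣ Z ∣) _ _ (≤-trans (hallF stableF) (≤-reflexive (sym size))))

    ⋆-onlyClassPairsˡ : OnlyClassPairs E → OnlyClassPairs (E ⋆ F)
    ⋆-onlyClassPairsˡ onlyE {X} {Z} tight = decidable-stable (isClassPair? X Z) do
      (_ , tightE , _) ← ⋆-tightPair⁻ tight
      return (classPair⁺ˡ (proj₂ tight) (Sum.map proj₁ proj₁ (onlyE tightE)))

    ⋆-onlyClassPairsʳ : OnlyClassPairs F → OnlyClassPairs (E ⋆ F)
    ⋆-onlyClassPairsʳ onlyF {X} {Z} tight = decidable-stable (isClassPair? X Z) do
      (_ , _ , tightF) ← ⋆-tightPair⁻ tight
      return (classPair⁺ʳ (proj₂ tight) (Sum.map proj₂ proj₂ (onlyF tightF)))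

  ⋆-bistableˡ : Bistable E → Hall F → Bistable (E ⋆ F)
  ⋆-bistableˡ bistableE hallF =
    hall×onlyClassPairs⇒bistable (⋆-hall hallE hallF)
      (⋆-onlyClassPairsˡ hallE hallF (bistable⇒onlyClassPairs bistableE))
    where hallE = bistable⇒hall bistableE

  ⋆-bistableʳ : Hall E → Bistable F → Bistable (E ⋆ F)
  ⋆-bistableʳ hallE bistableF =
    hall×onlyClassPairs⇒bistable (⋆-hall hallE hallF)
      (⋆-onlyClassPairsʳ hallE hallF (bistable⇒onlyClassPairs bistableF))
    where hallF = bistable⇒hall bistableF

PairAlphaPlusStable : BiGraph n → Set
PairAlphaPlusStable E = ∀ {k X Y a b} → StablePairsAtMost E k → StablePairOfSize E k X Y → ¬ E a b →
                        ∃₂ λ P Q → StablePairOfSize E k P Q × ¬ (a ∈ P × b ∈ Q)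

αPlusStable⇒pairAlphaPlusStable : {E : BiGraph n} → BiAlphaPlusStable E → PairAlphaPlusStable E
αPlusStable⇒pairAlphaPlusStable {n} {E} αPlus {k} {X} {Y} {a} {b} bounded maximum ¬Eab
  with αPlus (a ↑ˡ n) (n ↑ʳ b) (↑ˡ≢↑ʳ a b) (¬Eab ∘ subst id (underlying-↑ E a b)) k
         (X ++ Y , maximumPair⇒maxStable bounded maximum , trans (∣p++q∣≡∣p∣+∣q∣ X Y) (proj₂ maximum))
... | T , (stableT , _) , ∣T∣≡k with Vec.splitAt n T
... | P , Q , refl with stable-addEdge⁻ stableT
... | stable , ¬both =
  P , Q , (stable⇒stablePair stable , trans (sym (∣p++q∣≡∣p∣+∣q∣ P Q)) ∣T∣≡k) ,
  λ (a∈P , b∈Q) → ¬both (∈-++⁺ˡ a∈P , ∈-++⁺ʳ P b∈Q)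

uncross-size : (X Y P Q : Subset n) →
               (∣ X ∩ P ∣ + ∣ Y ∪ Q ∣) + (∣ X ∪ P ∣ + ∣ Y ∩ Q ∣) ≡ (∣ X ∣ + ∣ Y ∣) + (∣ P ∣ + ∣ Q ∣)
uncross-size X Y P Q = begin
  (∣ X ∩ P ∣ + ∣ Y ∪ Q ∣) + (∣ X ∪ P ∣ + ∣ Y ∩ Q ∣) ≡⟨ interchange (∣ X ∩ P ∣) (∣ Y ∪ Q ∣) _ _ ⟩
  (∣ X ∩ P ∣ + ∣ X ∪ P ∣) + (∣ Y ∪ Q ∣ + ∣ Y ∩ Q ∣)
    ≡⟨ cong₂ _+_ (∣p∩q∣+∣p∪q∣≡∣p∣+∣q∣ X P) (trans (+-comm (∣ Y ∪ Q ∣) _) (∣p∩q∣+∣p∪q∣≡∣p∣+∣q∣ Y Q)) ⟩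
  (∣ X ∣ + ∣ P ∣) + (∣ Y ∣ + ∣ Q ∣) ≡⟨ interchange (∣ X ∣) (∣ P ∣) _ _ ⟩
  (∣ X ∣ + ∣ Y ∣) + (∣ P ∣ + ∣ Q ∣) ∎
  where open ≡-Reasoning

m+n≡o+o⇒m≡o : ∀ {m n o} → m + n ≡ o + o → m ≤ o → n ≤ o → m ≡ o
m+n≡o+o⇒m≡o {m} {n} {o} m+n≡o+o m≤o n≤o =
  ≤-antisym m≤o (+-cancelʳ-≤ o o m (≤-trans (≤-reflexive (sym m+n≡o+o)) (+-monoʳ-≤ m n≤o)))

m+n≡o⇒n<o⇒0<m : ∀ m {n o} → m + n ≡ o → n < o → 0 < m
m+n≡o⇒n<o⇒0<m zero refl n<n = contradiction refl (<⇒≢ n<n)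
m+n≡o⇒n<o⇒0<m (suc m) _ _ = z<s

module _ {n} {E : BiGraph n} {k} (bounded : StablePairsAtMost E k) where

  uncross : ∀ {X Y P Q} → StablePairOfSize E k X Y → StablePairOfSize E k P Q →
            StablePairOfSize E k (X ∩ P) (Y ∪ Q) × StablePairOfSize E k (X ∪ P) (Y ∩ Q)
  uncross {X} {Y} {P} {Q} (stableXY , sizeXY) (stablePQ , sizePQ) =
    (stable∩∪ , m+n≡o+o⇒m≡o sum (bounded stable∩∪) (bounded stable∪∩)) ,
    (stable∪∩ ,
     m+n≡o+o⇒m≡o (trans (+-comm (∣ X ∪ P ∣ + ∣ Y ∩ Q ∣) _) sum) (bounded stable∪∩) (bounded stable∩∪))
    where
    stable∩∪ : StablePair E (X ∩ P) (Y ∪ Q)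
    stable∩∪ a∈X∩P b∈Y∪Q with x∈p∩q⁻ X P a∈X∩P | x∈p∪q⁻ Y Q b∈Y∪Q
    ... | a∈X , _ | inj₁ b∈Y = stableXY a∈X b∈Y
    ... | _ , a∈P | inj₂ b∈Q = stablePQ a∈P b∈Q

    stable∪∩ : StablePair E (X ∪ P) (Y ∩ Q)
    stable∪∩ a∈X∪P b∈Y∩Q with x∈p∪q⁻ X P a∈X∪P | x∈p∩q⁻ Y Q b∈Y∩Q
    ... | inj₁ a∈X | b∈Y , _ = stableXY a∈X b∈Y
    ... | inj₂ a∈P | _ , b∈Q = stablePQ a∈P b∈Q

    sum : (∣ X ∩ P ∣ + ∣ Y ∪ Q ∣) + (∣ X ∪ P ∣ + ∣ Y ∩ Q ∣) ≡ k + k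
    sum = trans (uncross-size X Y P Q) (cong₂ _+_ sizeXY sizePQ)

  leftMinimal⇒⊆ : ∀ {X Y P Q} → StablePairOfSize E k X Y →
                  (∀ {P Q} → StablePairOfSize E k P Q → ∣ X ∣ ≤ ∣ P ∣) →
                  StablePairOfSize E k P Q → X ⊆ P
  leftMinimal⇒⊆ maxXY least maxPQ = ∣p∣≤∣p∩q∣⇒p⊆q (least (proj₁ (uncross maxXY maxPQ)))

  rightMinimal⇒⊆ : ∀ {X Y P Q} → StablePairOfSize E k X Y →
                   (∀ {P Q} → StablePairOfSize E k P Q → ∣ Y ∣ ≤ ∣ Q ∣) →
                   StablePairOfSize E k P Q → Y ⊆ Q
  rightMinimal⇒⊆ maxXY least maxPQ = ∣p∣≤∣p∩q∣⇒p⊆q (least (proj₂ (uncross maxXY maxPQ)))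

  minimalPairs⇒k≤n : PairAlphaPlusStable E → ∀ {X₁ Y₁ X₂ Y₂} →
                     StablePairOfSize E k X₁ Y₁ → (∀ {P Q} → StablePairOfSize E k P Q → ∣ X₁ ∣ ≤ ∣ P ∣) →
                     StablePairOfSize E k X₂ Y₂ → (∀ {P Q} → StablePairOfSize E k P Q → ∣ Y₂ ∣ ≤ ∣ Q ∣) →
                     k ≤ n
  minimalPairs⇒k≤n αPlus {X₁} {Y₁} {X₂} {Y₂} max₁ least₁ max₂ least₂ = ≮⇒≥ λ n<k →
    let a , a∈X₁ = 0<∣p∣⇒Nonempty (m+n≡o⇒n<o⇒0<m ∣ X₁ ∣ (proj₂ max₁) (≤-<-trans (∣p∣≤n Y₁) n<k))
        b , b∈Y₂ = 0<∣p∣⇒Nonempty (m+n≡o⇒n<o⇒0<m ∣ Y₂ ∣ (trans (+-comm ∣ Y₂ ∣ _) (proj₂ max₂))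
                                                   (≤-<-trans (∣p∣≤n X₂) n<k))
        ¬Eab = proj₁ max₁ a∈X₁ (rightMinimal⇒⊆ max₂ least₂ max₁ b∈Y₂)
        _ , _ , maxPQ , ¬both = αPlus bounded max₁ ¬Eab
    in ¬both (leftMinimal⇒⊆ max₁ least₁ maxPQ a∈X₁ , rightMinimal⇒⊆ max₂ least₂ maxPQ b∈Y₂)

  maximum≤n : PairAlphaPlusStable E → ∀ {X Y} → StablePairOfSize E k X Y → ¬ ¬ (k ≤ n)
  maximum≤n αPlus maxXY = do
    (_ , max₁ , least₁) ← ¬¬-least (uncurry (StablePairOfSize E k)) (∣_∣ ∘ proj₁) maxXY
    (_ , max₂ , least₂) ← ¬¬-least (uncurry (StablePairOfSize E k)) (∣_∣ ∘ proj₂) maxXY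
    return (minimalPairs⇒k≤n αPlus max₁ least₁ max₂ least₂)

pairAlphaPlusStable⇒hall : {E : BiGraph n} → PairAlphaPlusStable E → Hall E
pairAlphaPlusStable⇒hall {n} {E} αPlus stable = decidable-stable (_ ≤? n) do
  (_ , stablePQ , greatest) ← ¬¬-greatest (uncurry (StablePair E)) (λ (P , Q) → ∣ P ∣ + ∣ Q ∣)
                                (λ {(P , Q)} _ → +-mono-≤ (∣p∣≤n P) (∣p∣≤n Q)) stable
  k≤n ← maximum≤n greatest αPlus (stablePQ , refl)
  return (≤-trans (greatest stable) k≤n)

αPlusStable⇒hall : {E : BiGraph n} → BiAlphaPlusStable E → Hall E
αPlusStable⇒hall = pairAlphaPlusStable⇒hall ∘ αPlusStable⇒pairAlphaPlusStable

proposition10 : (n : ℕ) (E F : BiGraph n) →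
    (BiAlphaPlusStable E → BiAlphaPlusStable F → BiAlphaPlusStable (E ⋆ F))
    × ((BiAlphaPlusStable E × Bistable F) ⊎ (Bistable E × BiAlphaPlusStable F) → Bistable (E ⋆ F))
    × (Bistable E → Bistable F → Bistable (E ⋆ F))
proposition10 n E F = αPlusStable-⋆ , mixed-⋆ , bistable-⋆
  where
  αPlusStable-⋆ : BiAlphaPlusStable E → BiAlphaPlusStable F → BiAlphaPlusStable (E ⋆ F)
  αPlusStable-⋆ αE αF = hall⇒αPlusStable (⋆-hall {E = E} {F} (αPlusStable⇒hall αE) (αPlusStable⇒hall αF))

  mixed-⋆ : (BiAlphaPlusStable E × Bistable F) ⊎ (Bistable E × BiAlphaPlusStable F) → Bistable (E ⋆ F)
  mixed-⋆ (inj₁ (αE , bistableF)) = ⋆-bistableʳ (αPlusStable⇒hall αE) bistableF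
  mixed-⋆ (inj₂ (bistableE , αF)) = ⋆-bistableˡ bistableE (αPlusStable⇒hall αF)

  bistable-⋆ : Bistable E → Bistable F → Bistable (E ⋆ F)
  bistable-⋆ bistableE bistableF = ⋆-bistableˡ bistableE (bistable⇒hall bistableF)
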